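{- For every rooted tree $\tau$, $$\prod_{v\in\tau} b(v)\;\le\;\prod_{v\in\tau} d(v).$$ Moreover, equality holds if and only if $\tau$ is a path with an endpoint at the root $R$.
   Context: A rooted tree $\tau$ is a finite tree with a distinguished vertex $R$, the root. For a vertex $v$, $b(v)$ is the size of the branch below $v$, i.e. the number of vertices $w$ (including $v$ itself) such that $v$ lies on the path from $w$ to $R$. $d(v)$ is the number of vertices on the shortest path from $v$ to $R$ (including both endpoints; so $d(R)=1$). -}

module Defs where

open import Data.Nat using (ℕ; zero; suc; _+_)
open import Data.List using (List; []; _∷_; _++_)

-- A (finite) rooted tree: the root together with the list of subtrees
-- hanging from its children.  (Child order is irrelevant for the products
-- considered below.)
data RTree : Set where
  node : List RTree → RTree

mutual
  size : RTree → ℕ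
  size (node ts) = suc (sizeF ts)

  sizeF : List RTree → ℕ
  sizeF []       = 0
  sizeF (t ∷ ts) = size t + sizeF ts

-- bs t : the list of the values b(v), one entry for every vertex v of t,
-- where b(v) is the number of vertices in the branch below v (v included).
mutual
  bs : RTree → List ℕ
  bs (node ts) = suc (sizeF ts) ∷ bsF ts

  bsF : List RTree → List ℕ
  bsF []       = []
  bsF (t ∷ ts) = bs t ++ bsF ts

-- ds k t : the list of values d(v), one entry per vertex v of t, when the
-- root of t sits at depth k (depth counted in vertices, so the global root
-- has d(R) = 1).
mutual
  ds : ℕ → RTree → List ℕ
  ds k (node ts) = k ∷ dsF (suc k) ts

  dsF : ℕ → List RTree → List ℕ
  dsF k []       = []
  dsF k (t ∷ ts) = ds k t ++ dsF k ts

data IsRootPath : RTree → Set where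
  leaf : IsRootPath (node [])
  step : ∀ {t} → IsRootPath t → IsRootPath (node (t ∷ []))

module Submission where

open import Defs
open import Data.Nat using (ℕ; _≤_)
open import Data.Nat.ListAction using (product)
open import Data.Product using (_×_)
open import Function.Bundles using (_⇔_)
open import Relation.Binary.PropositionalEquality using (_≡_)

open import Data.Nat using (zero; suc; _+_; _*_; _<_; _!; NonZero; z≤n; s≤s)
open import Data.Nat.Properties
open import Data.Nat.ListAction.Properties using (product-++)
open import Data.Nat.Tactic.RingSolver using (solve-∀)
open import Data.List using (List; []; _∷_; _++_)
open import Data.List.Properties using (++-identityʳ)
open import Data.Product using (_,_)
open import Data.Empty using (⊥-elim)
open import Function.Bundles using (mk⇔; module Equivalence)
open import Relation.Binary.PropositionalEquality
  using (refl; sym; trans; cong; cong₂; subst; module ≡-Reasoning)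

open Equivalence using (to; from)

-- Let t hang below j ancestors, have n vertices, and let d be the depth inside t.  The induction proves
--   ∏ b(v) · (j+1)(j+2)⋯(j+n) ≤ ∏ (j + d(v)) · n!,   i.e.   ∏ b(v) · C(j+n, n) ≤ ∏ (j + d(v)),
-- which for j = 0 is the theorem.  At the root the factors b = n and j + 1 reduce the claim to
-- the same claim for the forest of children, now below j + 1 ancestors.  Splitting a forest
-- into its first tree (a vertices) and the rest (b vertices) costs the binomial inequality
-- C(J+a+b, a+b) ≤ C(J+a, a) · C(J+b, b), which is strict when J, a, b ≥ 1.  So a vertex with
-- two children makes the inequality strict, and equality holds exactly for root paths.

rising : ℕ → ℕ → ℕ
rising j zero    = 1
rising j (suc m) = (suc j + m) * rising j m

rising-0 : ∀ m → rising 0 m ≡ m !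
rising-0 zero    = refl
rising-0 (suc m) = cong (suc m *_) (rising-0 m)

rising-shift : ∀ j m → rising j (suc m) ≡ suc j * rising (suc j) m
rising-shift j zero    = cong (_* 1) (+-identityʳ (suc j))
rising-shift j (suc m) = begin
  (suc j + suc m) * rising j (suc m)            ≡⟨ cong ((suc j + suc m) *_) (rising-shift j m) ⟩
  (suc j + suc m) * (suc j * rising (suc j) m)  ≡⟨ regroup j m (rising (suc j) m) ⟩
  suc j * ((suc (suc j) + m) * rising (suc j) m) ∎
  where
  open ≡-Reasoning
  regroup : ∀ j m r → (suc j + suc m) * (suc j * r) ≡ suc j * ((suc (suc j) + m) * r)
  regroup = solve-∀

rising≢0 : ∀ j m → NonZero (rising j m)
rising≢0 j zero    = _
rising≢0 j (suc m) = m*n≢0 (suc j + m) (rising j m) {{_}} {{rising≢0 j m}}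

-- C(J+a+b, a+b) ≤ C(J+a, a) · C(J+b, b), multiplied out; raising b by one multiplies the two
-- sides by the factors below, which differ by a · J.

rising-split-factor : ∀ J a b → (suc J + (a + b)) * suc b + a * J ≡ suc (a + b) * (suc J + b)
rising-split-factor = solve-∀

rising-split-lhs-suc : ∀ J a b →
  rising J (a + suc b) * (a ! * suc b !) ≡
  (suc J + (a + b)) * suc b * (rising J (a + b) * (a ! * b !))
rising-split-lhs-suc J a b rewrite +-suc a b = regroup (suc J + (a + b)) (rising J (a + b)) (a !) (b !) b
  where
  regroup : ∀ c r x y b → c * r * (x * (suc b * y)) ≡ c * suc b * (r * (x * y))
  regroup = solve-∀

rising-split-rhs-suc : ∀ J a b →
  (a + suc b) ! * (rising J a * rising J (suc b)) ≡
  suc (a + b) * (suc J + b) * ((a + b) ! * (rising J a * rising J b))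
rising-split-rhs-suc J a b rewrite +-suc a b = regroup (a + b) ((a + b) !) (rising J a) (suc J + b) (rising J b)
  where
  regroup : ∀ n f r c s → suc n * f * (r * (c * s)) ≡ suc n * c * (f * (r * s))
  regroup = solve-∀

rising-split-≤ : ∀ J a b → rising J (a + b) * (a ! * b !) ≤ (a + b) ! * (rising J a * rising J b)
rising-split-≤ J a zero = ≤-reflexive (begin
  rising J (a + 0) * (a ! * 1)   ≡⟨ cong₂ (λ n x → rising J n * x) (+-identityʳ a) (*-identityʳ (a !)) ⟩
  rising J a * a !               ≡⟨ *-comm (rising J a) (a !) ⟩
  a ! * rising J a               ≡⟨ cong₂ (λ n x → n ! * x) (sym (+-identityʳ a)) (sym (*-identityʳ (rising J a))) ⟩
  (a + 0) ! * (rising J a * 1)   ∎)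
  where open ≡-Reasoning
rising-split-≤ J a (suc b) = begin
  rising J (a + suc b) * (a ! * suc b !)                              ≡⟨ rising-split-lhs-suc J a b ⟩
  (suc J + (a + b)) * suc b * (rising J (a + b) * (a ! * b !))        ≤⟨ *-mono-≤ factor-≤ (rising-split-≤ J a b) ⟩
  suc (a + b) * (suc J + b) * ((a + b) ! * (rising J a * rising J b)) ≡⟨ sym (rising-split-rhs-suc J a b) ⟩
  (a + suc b) ! * (rising J a * rising J (suc b))                     ∎
  where
  open ≤-Reasoning
  factor-≤ : (suc J + (a + b)) * suc b ≤ suc (a + b) * (suc J + b)
  factor-≤ = subst ((suc J + (a + b)) * suc b ≤_) (rising-split-factor J a b) (m≤m+n _ (a * J))

rising-split-< : ∀ J a b →
  rising (suc J) (suc a + suc b) * (suc a ! * suc b !) <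
  (suc a + suc b) ! * (rising (suc J) (suc a) * rising (suc J) (suc b))
rising-split-< J a b = begin-strict
  rising J′ (a′ + suc b) * (a′ ! * suc b !)                              ≡⟨ rising-split-lhs-suc J′ a′ b ⟩
  (suc J′ + (a′ + b)) * suc b * (rising J′ (a′ + b) * (a′ ! * b !))      ≤⟨ *-monoʳ-≤ ((suc J′ + (a′ + b)) * suc b) (rising-split-≤ J′ a′ b) ⟩
  (suc J′ + (a′ + b)) * suc b * ((a′ + b) ! * (rising J′ a′ * rising J′ b)) <⟨ *-monoˡ-< ((a′ + b) ! * (rising J′ a′ * rising J′ b)) {{rhs≢0}} factor-< ⟩
  suc (a′ + b) * (suc J′ + b) * ((a′ + b) ! * (rising J′ a′ * rising J′ b)) ≡⟨ sym (rising-split-rhs-suc J′ a′ b) ⟩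
  (a′ + suc b) ! * (rising J′ a′ * rising J′ (suc b))                    ∎
  where
  open ≤-Reasoning
  J′ = suc J
  a′ = suc a
  factor-< : (suc J′ + (a′ + b)) * suc b < suc (a′ + b) * (suc J′ + b)
  factor-< = subst ((suc J′ + (a′ + b)) * suc b <_) (rising-split-factor J′ a′ b) (m<m+n _ (s≤s z≤n))
  rhs≢0 : NonZero ((a′ + b) ! * (rising J′ a′ * rising J′ b))
  rhs≢0 = m*n≢0 _ _ {{(a′ + b) !≢0}} {{m*n≢0 _ _ {{rising≢0 J′ a′}} {{rising≢0 J′ b}}}}

branchWeight : ℕ → RTree → ℕ
branchWeight j t = product (bs t) * rising j (size t)

depthWeight : ℕ → RTree → ℕ
depthWeight j t = product (ds (suc j) t) * size t !

branchWeightF : ℕ → List RTree → ℕ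
branchWeightF j ts = product (bsF ts) * rising j (sizeF ts)

depthWeightF : ℕ → List RTree → ℕ
depthWeightF j ts = product (dsF (suc j) ts) * sizeF ts !

Tight : ℕ → RTree → Set
Tight j t = branchWeight j t ≡ depthWeight j t

TightF : ℕ → List RTree → Set
TightF j ts = branchWeightF j ts ≡ depthWeightF j ts

branchWeight-0 : ∀ t → branchWeight 0 t ≡ product (bs t) * size t !
branchWeight-0 t = cong (product (bs t) *_) (rising-0 (size t))

branchWeight-node : ∀ j ts → branchWeight j (node ts) ≡ suc (sizeF ts) * suc j * branchWeightF (suc j) ts
branchWeight-node j ts = begin
  suc M * p * rising j (suc M)           ≡⟨ cong (suc M * p *_) (rising-shift j M) ⟩
  suc M * p * (suc j * rising (suc j) M) ≡⟨ regroup M p j (rising (suc j) M) ⟩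
  suc M * suc j * (p * rising (suc j) M) ∎
  where
  open ≡-Reasoning
  M = sizeF ts
  p = product (bsF ts)
  regroup : ∀ M p j r → suc M * p * (suc j * r) ≡ suc M * suc j * (p * r)
  regroup = solve-∀

depthWeight-node : ∀ j ts → depthWeight j (node ts) ≡ suc (sizeF ts) * suc j * depthWeightF (suc j) ts
depthWeight-node j ts = regroup j (product (dsF (suc (suc j)) ts)) (sizeF ts) (sizeF ts !)
  where
  regroup : ∀ j p M f → suc j * p * (suc M * f) ≡ suc M * suc j * (p * f)
  regroup = solve-∀

node-tight⇔ : ∀ j ts → Tight j (node ts) ⇔ TightF (suc j) ts
node-tight⇔ j ts = mk⇔
  (λ eq → *-cancelˡ-≡ _ _ c (trans (sym (branchWeight-node j ts)) (trans eq (depthWeight-node j ts))))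
  (λ eq → trans (branchWeight-node j ts) (trans (cong (c *_) eq) (sym (depthWeight-node j ts))))
  where c = suc (sizeF ts) * suc j

singleton-tight⇔ : ∀ j t → TightF j (t ∷ []) ⇔ Tight j t
singleton-tight⇔ j t = mk⇔
  (λ eq → trans (sym branch) (trans eq depth))
  (λ eq → trans branch (trans eq (sym depth)))
  where
  branch : branchWeightF j (t ∷ []) ≡ branchWeight j t
  branch = cong₂ (λ xs n → product xs * rising j n) (++-identityʳ (bs t)) (+-identityʳ (size t))
  depth : depthWeightF j (t ∷ []) ≡ depthWeight j t
  depth = cong₂ (λ xs n → product xs * n !) (++-identityʳ (ds (suc j) t)) (+-identityʳ (size t))

module _ (j : ℕ) (t : RTree) (ts : List RTree) where

  private
    a = size t
    b = sizeF ts
    p = product (bs t)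
    q = product (bsF ts)

  branchWeightF-∷ : branchWeightF j (t ∷ ts) * (size t ! * sizeF ts !) ≡
                    product (bs t) * product (bsF ts) * (rising j (size t + sizeF ts) * (size t ! * sizeF ts !))
  branchWeightF-∷ = begin
    product (bs t ++ bsF ts) * r * f ≡⟨ cong (λ x → x * r * f) (product-++ (bs t) (bsF ts)) ⟩
    p * q * r * f                    ≡⟨ *-assoc (p * q) r f ⟩
    p * q * (r * f)                  ∎
    where
    open ≡-Reasoning
    r = rising j (a + b)
    f = a ! * b !

  branchWeights-∷ : product (bs t) * product (bsF ts) * ((size t + sizeF ts) ! * (rising j (size t) * rising j (sizeF ts))) ≡
                    (size t + sizeF ts) ! * (branchWeight j t * branchWeightF j ts)
  branchWeights-∷ = regroup p q ((a + b) !) (rising j a) (rising j b)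
    where
    regroup : ∀ p q f r s → p * q * (f * (r * s)) ≡ f * (p * r * (q * s))
    regroup = solve-∀

  depthWeightF-∷ : depthWeightF j (t ∷ ts) * (size t ! * sizeF ts !) ≡
                   (size t + sizeF ts) ! * (depthWeight j t * depthWeightF j ts)
  depthWeightF-∷ = begin
    product (ds (suc j) t ++ dsF (suc j) ts) * (a + b) ! * (a ! * b !)
      ≡⟨ cong (λ x → x * (a + b) ! * (a ! * b !)) (product-++ (ds (suc j) t) (dsF (suc j) ts)) ⟩
    product (ds (suc j) t) * product (dsF (suc j) ts) * (a + b) ! * (a ! * b !)
      ≡⟨ regroup (product (ds (suc j) t)) (product (dsF (suc j) ts)) ((a + b) !) (a !) (b !) ⟩
    (a + b) ! * (depthWeight j t * depthWeightF j ts) ∎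
    where
    open ≡-Reasoning
    regroup : ∀ d e f x y → d * e * f * (x * y) ≡ f * (d * x * (e * y))
    regroup = solve-∀

mutual
  product-bs≢0 : ∀ t → NonZero (product (bs t))
  product-bs≢0 (node ts) = m*n≢0 (suc (sizeF ts)) _ {{_}} {{product-bsF≢0 ts}}

  product-bsF≢0 : ∀ ts → NonZero (product (bsF ts))
  product-bsF≢0 []       = _
  product-bsF≢0 (t ∷ ts) = subst NonZero (sym (product-++ (bs t) (bsF ts)))
                             (m*n≢0 _ _ {{product-bs≢0 t}} {{product-bsF≢0 ts}})

mutual
  branchWeight≤depthWeight : ∀ j t → branchWeight j t ≤ depthWeight j t
  branchWeight≤depthWeight j (node ts) = begin
    branchWeight j (node ts)      ≡⟨ branchWeight-node j ts ⟩
    c * branchWeightF (suc j) ts  ≤⟨ *-monoʳ-≤ c (branchWeightF≤depthWeightF (suc j) ts) ⟩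
    c * depthWeightF (suc j) ts   ≡⟨ sym (depthWeight-node j ts) ⟩
    depthWeight j (node ts)       ∎
    where
    open ≤-Reasoning
    c = suc (sizeF ts) * suc j

  branchWeightF≤depthWeightF : ∀ j ts → branchWeightF j ts ≤ depthWeightF j ts
  branchWeightF≤depthWeightF j []       = ≤-refl
  branchWeightF≤depthWeightF j (t ∷ ts) = *-cancelʳ-≤ _ _ (a ! * b !) {{a !* b !≢0}} (begin
    branchWeightF j (t ∷ ts) * (a ! * b !)              ≡⟨ branchWeightF-∷ j t ts ⟩
    p * (rising j (a + b) * (a ! * b !))                ≤⟨ *-monoʳ-≤ p (rising-split-≤ j a b) ⟩
    p * ((a + b) ! * (rising j a * rising j b))         ≡⟨ branchWeights-∷ j t ts ⟩
    (a + b) ! * (branchWeight j t * branchWeightF j ts) ≤⟨ *-monoʳ-≤ ((a + b) !) (*-mono-≤ (branchWeight≤depthWeight j t)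
                                                                                         (branchWeightF≤depthWeightF j ts)) ⟩
    (a + b) ! * (depthWeight j t * depthWeightF j ts)   ≡⟨ sym (depthWeightF-∷ j t ts) ⟩
    depthWeightF j (t ∷ ts) * (a ! * b !)               ∎)
    where
    open ≤-Reasoning
    a = size t
    b = sizeF ts
    p = product (bs t) * product (bsF ts)

branchWeightF<depthWeightF : ∀ j t u us → branchWeightF (suc j) (t ∷ u ∷ us) < depthWeightF (suc j) (t ∷ u ∷ us)
branchWeightF<depthWeightF j t@(node ws) u@(node vs) us = *-cancelʳ-< (a ! * b !) _ _ (begin-strict
  branchWeightF J (t ∷ ts) * (a ! * b !)              ≡⟨ branchWeightF-∷ J t ts ⟩
  p * (rising J (a + b) * (a ! * b !))                <⟨ *-monoʳ-< p {{p≢0}} (rising-split-< j (sizeF ws) (sizeF vs + sizeF us)) ⟩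
  p * ((a + b) ! * (rising J a * rising J b))         ≡⟨ branchWeights-∷ J t ts ⟩
  (a + b) ! * (branchWeight J t * branchWeightF J ts) ≤⟨ *-monoʳ-≤ ((a + b) !) (*-mono-≤ (branchWeight≤depthWeight J t)
                                                                                       (branchWeightF≤depthWeightF J ts)) ⟩
  (a + b) ! * (depthWeight J t * depthWeightF J ts)   ≡⟨ sym (depthWeightF-∷ J t ts) ⟩
  depthWeightF J (t ∷ ts) * (a ! * b !)               ∎)
  where
  open ≤-Reasoning
  J = suc j
  ts = u ∷ us
  a = size t
  b = sizeF ts
  p = product (bs t) * product (bsF ts)
  p≢0 : NonZero p
  p≢0 = m*n≢0 _ _ {{product-bs≢0 t}} {{product-bsF≢0 ts}}

rootPath⇒tight : ∀ {j t} → IsRootPath t → Tight j t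
rootPath⇒tight {j} leaf         = from (node-tight⇔ j []) refl
rootPath⇒tight {j} (step {t} p) = from (node-tight⇔ j (t ∷ [])) (from (singleton-tight⇔ (suc j) t) (rootPath⇒tight p))

tight⇒rootPath : ∀ {j} t → Tight j t → IsRootPath t
tight⇒rootPath     (node [])           _  = leaf
tight⇒rootPath {j} (node (t ∷ []))     eq = step (tight⇒rootPath t (to (singleton-tight⇔ (suc j) t) (to (node-tight⇔ j (t ∷ [])) eq)))
tight⇒rootPath {j} (node (t ∷ u ∷ us)) eq = ⊥-elim (<⇒≢ (branchWeightF<depthWeightF j t u us) (to (node-tight⇔ j (t ∷ u ∷ us)) eq))

theorem2p1 : (τ : RTree) →
    (product (bs τ) ≤ product (ds 1 τ)) ×
    ((product (bs τ) ≡ product (ds 1 τ)) ⇔ IsRootPath τ)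
theorem2p1 τ =
    *-cancelʳ-≤ _ _ (size τ !) {{size τ !≢0}} (subst (_≤ depthWeight 0 τ) (branchWeight-0 τ) (branchWeight≤depthWeight 0 τ))
  , mk⇔ (λ eq → tight⇒rootPath τ (trans (branchWeight-0 τ) (cong (_* size τ !) eq)))
        (λ p → *-cancelʳ-≡ _ _ (size τ !) {{size τ !≢0}} (trans (sym (branchWeight-0 τ)) (rootPath⇒tight p)))
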